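{- Let $G$ be a finite simple graph with no s-duo. Then for every vertex $v \in V(G)$, the s-duos of $G - v$ are pairwise disjoint.
   Context: A subset $M \subseteq V(G)$ is a module of the graph $G$ if for all $x,y \in M$ and all $w \in V(G)\setminus M$, $w$ is adjacent to $x$ iff $w$ is adjacent to $y$. An s-duo of $G$ is a module $\{a,b\}$ of $G$ with $a\neq b$ and $a,b$ non-adjacent. $G - v$ is the subgraph induced by $V(G)\setminus\{v\}$. -}

module Defs where

open import Data.Nat using (ℕ; suc)
open import Data.Fin using (Fin; punchIn)
open import Data.Product using (_×_)
open import Data.Sum using (_⊎_)
open import Relation.Nullary using (¬_)
open import Relation.Binary.PropositionalEquality using (_≡_; _≢_)
open import Function.Bundles using (_⇔_)

record Graph (n : ℕ) : Set₁ where
  field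
    Adj   : Fin n → Fin n → Set
    sym   : ∀ {x y} → Adj x y → Adj y x
    irrefl : ∀ {x} → ¬ Adj x x
open Graph public

-- G - v : subgraph induced by V(G) \ {v}; vertices of G - v are Fin m,
-- identified with V(G) \ {v} via the injection  punchIn v.
delete : ∀ {m} → Graph (suc m) → Fin (suc m) → Graph m
delete G v = record
  { Adj = λ x y → Adj G (punchIn v x) (punchIn v y)
  ; sym = Graph.sym G
  ; irrefl = Graph.irrefl G
  }

-- {a,b} is a module: every w outside {a,b} is adjacent to a iff adjacent to b
-- (for a two-element set this is exactly the module condition).
IsModule₂ : ∀ {n} → Graph n → Fin n → Fin n → Set
IsModule₂ G a b = ∀ w → w ≢ a → w ≢ b → (Adj G w a ⇔ Adj G w b)

IsSDuo : ∀ {n} → Graph n → Fin n → Fin n → Set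
IsSDuo G a b = (a ≢ b) × ¬ Adj G a b × IsModule₂ G a b

NoSDuo : ∀ {n} → Graph n → Set
NoSDuo G = ∀ a b → ¬ IsSDuo G a b

SamePair : ∀ {n} → Fin n → Fin n → Fin n → Fin n → Set
SamePair a b c d = (a ≡ c × b ≡ d) ⊎ (a ≡ d × b ≡ c)

DisjointPair : ∀ {n} → Fin n → Fin n → Fin n → Fin n → Set
DisjointPair a b c d = a ≢ c × a ≢ d × b ≢ c × b ≢ d

SDuosPairwiseDisjoint : ∀ {n} → Graph n → Set
SDuosPairwiseDisjoint G =
  ∀ a b c d → IsSDuo G a b → IsSDuo G c d →
  ¬ SamePair a b c d → DisjointPair a b c d

-- If {x,y} and {x,z} were two different s-duos of G - v, then {y,z} would be one too: in any
-- graph, vertices of a common s-duo are false twins, and being false twins is transitive.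
-- None of the three pairs is an s-duo of G, so v must be adjacent to exactly one vertex of
-- each pair; but adjacency to v takes only two values, so two of x, y, z agree on it.
module Submission where

open import Defs
open import Data.Nat using (ℕ; suc)
open import Data.Fin using (Fin; punchIn; punchOut; _≟_)
open import Data.Fin.Properties using (punchIn-injective; punchIn-punchOut)
open import Data.Product using (_,_)
open import Data.Sum using (inj₁; inj₂)
open import Data.Empty using (⊥-elim)
open import Function using (_∘_; const)
open import Function.Bundles using (_⇔_; mk⇔; Equivalence)
open import Function.Properties.Equivalence using () renaming (sym to ⇔-sym; trans to ⇔-trans)
open import Relation.Nullary using (¬_; yes; no)
open import Relation.Nullary.Decidable using (decidable-stable)
open import Relation.Binary.PropositionalEquality using (_≡_; _≢_; refl; cong; subst; ≢-sym)

open Equivalence using (from)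

⇔-of-both-false : {A B : Set} → ¬ A → ¬ B → A ⇔ B
⇔-of-both-false ¬a ¬b = mk⇔ (⊥-elim ∘ ¬a) (⊥-elim ∘ ¬b)

¬⇔-¬⇔⇒¬¬⇔ : {P Q R : Set} → ¬ (P ⇔ Q) → ¬ (P ⇔ R) → ¬ ¬ (Q ⇔ R)
¬⇔-¬⇔⇒¬¬⇔ {P} {Q} {R} P⇎Q P⇎R Q⇎R = P⇎Q (⇔-of-both-false ¬p ¬q)
  where
  ¬p : ¬ P
  ¬p p = Q⇎R (⇔-of-both-false (λ q → P⇎Q (mk⇔ (const q) (const p)))
                              (λ r → P⇎R (mk⇔ (const r) (const p))))
  ¬q : ¬ Q
  ¬q q = P⇎R (⇔-of-both-false ¬p (λ r → Q⇎R (mk⇔ (const r) (const q))))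

IsSDuo-sym : ∀ {n} (G : Graph n) {a b} → IsSDuo G a b → IsSDuo G b a
IsSDuo-sym G (a≢b , a≁b , module-ab) =
  ≢-sym a≢b , a≁b ∘ Graph.sym G ,
  λ w w≢b w≢a → ⇔-sym (module-ab w w≢a w≢b)

IsSDuo-trans : ∀ {n} (G : Graph n) {x y z} →
               IsSDuo G x y → IsSDuo G x z → y ≢ z → IsSDuo G y z
IsSDuo-trans G {x} {y} {z} (x≢y , x≁y , module-xy) (x≢z , x≁z , module-xz) y≢z =
  y≢z , y≁z , module-yz
  where
  y≁z : ¬ Adj G y z
  y≁z y~z = x≁z (Graph.sym G (from (module-xy z (≢-sym x≢z) (≢-sym y≢z)) (Graph.sym G y~z)))

  module-yz : IsModule₂ G y z
  module-yz w w≢y w≢z with w ≟ x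
  ... | yes refl = ⇔-of-both-false x≁y x≁z
  ... | no w≢x   = ⇔-trans (⇔-sym (module-xy w w≢x w≢y)) (module-xz w w≢x w≢z)

data DeletionView {m : ℕ} (v : Fin (suc m)) : Fin (suc m) → Set where
  deleted   : DeletionView v v
  remaining : ∀ u → DeletionView v (punchIn v u)

deletionView : ∀ {m} (v w : Fin (suc m)) → DeletionView v w
deletionView v w with v ≟ w
... | yes refl = deleted
... | no v≢w   = subst (DeletionView v) (punchIn-punchOut v≢w) (remaining (punchOut v≢w))

IsSDuo-delete⇒IsSDuo : ∀ {m} (G : Graph (suc m)) (v : Fin (suc m)) {p q} →
                       IsSDuo (delete G v) p q →
                       (Adj G v (punchIn v p) ⇔ Adj G v (punchIn v q)) →
                       IsSDuo G (punchIn v p) (punchIn v q)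
IsSDuo-delete⇒IsSDuo G v {p} {q} (p≢q , p≁q , module-pq) v~p⇔v~q =
  p≢q ∘ punchIn-injective v p q , p≁q , module-G
  where
  module-G : IsModule₂ G (punchIn v p) (punchIn v q)
  module-G w w≢p w≢q with deletionView v w
  ... | deleted     = v~p⇔v~q
  ... | remaining u = module-pq u (w≢p ∘ cong (punchIn v)) (w≢q ∘ cong (punchIn v))

sduos-of-delete-share-no-vertex : ∀ {m} (G : Graph (suc m)) → NoSDuo G → ∀ v {x y z} →
                                  IsSDuo (delete G v) x y → IsSDuo (delete G v) x z → y ≡ z
sduos-of-delete-share-no-vertex G noSDuo v {y = y} {z = z} duo-xy duo-xz =
  decidable-stable (y ≟ z) λ y≢z →
    ¬⇔-¬⇔⇒¬¬⇔ (separated duo-xy) (separated duo-xz)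
              (separated (IsSDuo-trans (delete G v) duo-xy duo-xz y≢z))
  where
  separated : ∀ {p q} → IsSDuo (delete G v) p q →
              ¬ (Adj G v (punchIn v p) ⇔ Adj G v (punchIn v q))
  separated duo = noSDuo _ _ ∘ IsSDuo-delete⇒IsSDuo G v duo

lemma3 : ∀ {m : ℕ} (G : Graph (suc m)) → NoSDuo G →
         ∀ (v : Fin (suc m)) → SDuosPairwiseDisjoint (delete G v)
lemma3 {m} G noSDuo v a b c d duo-ab duo-cd ¬same = a≢c , a≢d , b≢c , b≢d
  where
  H : Graph m
  H = delete G v
  shared : ∀ {x y z} → IsSDuo H x y → IsSDuo H x z → y ≡ z
  shared = sduos-of-delete-share-no-vertex G noSDuo v

  a≢c : a ≢ c
  a≢c refl = ¬same (inj₁ (refl , shared duo-ab duo-cd))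
  a≢d : a ≢ d
  a≢d refl = ¬same (inj₂ (refl , shared duo-ab (IsSDuo-sym H duo-cd)))
  b≢c : b ≢ c
  b≢c refl = ¬same (inj₂ (shared (IsSDuo-sym H duo-ab) duo-cd , refl))
  b≢d : b ≢ d
  b≢d refl = ¬same (inj₁ (shared (IsSDuo-sym H duo-ab) (IsSDuo-sym H duo-cd) , refl))
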